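{- Let $p\geq 2$ be an integer and let $a_0,\ldots,a_{p-1},b_0,\ldots,b_{p-1}$ be integers such that $p \mid i a_i + b_i$ and $\gcd(a_i,p)=1$ for each $i\in\{0,\ldots,p-1\}$, and let $f$ be defined by $f(n)=(a_i n+b_i)/p$ whenever $n\equiv i \pmod p$. For every $k\geq1$, the graphs $C^{(f)}(p,k)$ and $B(p,k)$ are isomorphic, and the map $\Phi^{(f)}_{p,k}:\{0,\ldots,p^k-1\}\to\{0,\ldots,p^k-1\}$, $\Phi^{(f)}_{p,k}(n)=\sum_{i=0}^{k-1}x^{(f)}_i(n)\,p^i$, is an isomorphism from $C^{(f)}(p,k)$ to $B(p,k)$. Furthermore, the graphs $C^{(f)}(\mathbb{Z}_p)$ and $B(\mathbb{Z}_p)$ are isomorphic, and the map $\Phi^{(f)}_p:\mathbb{Z}_p\to\mathbb{Z}_p$, $\Phi^{(f)}_p(n)=\sum_{i=0}^{\infty}x^{(f)}_i(n)\,p^i$, is an isomorphism from $C^{(f)}(\mathbb{Z}_p)$ to $B(\mathbb{Z}_p)$ satisfying $f=(\Phi^{(f)}_p)^{ -1}\circ\sigma_p\circ\Phi^{(f)}_p$.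
   Context: All graphs are directed. $\mathbb{Z}_p$ denotes the $p$-adic integers (inverse limit of $\mathbb{Z}/p^k\mathbb{Z}$); $f$ is defined on $\mathbb{Z}$ and extended to $\mathbb{Z}_p$ by the same formula. Let $x^{(f)}_i(n)\in\{0,\ldots,p-1\}$ be defined by $x^{(f)}_i(n)\equiv f^i(n)\pmod p$, where $f^0(n)=n$ and $f^{j+1}=f\circ f^j$. $C^{(f)}(p,k)$ is the graph with vertex set $\{0,\ldots,p^k-1\}$ and an edge from $u$ to $v$ iff there exist integers $u_1\equiv u$, $v_1\equiv v\pmod{p^k}$ with $f(u_1)=v_1$. $C^{(f)}(\mathbb{Z}_p)$ has vertex set $\mathbb{Z}_p$ and edges $n\to f(n)$. The $p$-ary De Bruijn graph $B(p,k)$ has vertex set $\{0,\ldots,p^k-1\}$, a number $\sum_{i=0}^{k-1}c_ip^i$ ($c_i\in\{0,\ldots,p-1\}$) identified with the word $c_0c_1\cdots c_{k-1}$, and an edge from $a_0\cdots a_{k-1}$ to $c_0\cdots c_{k-1}$ iff $a_{i+1}=c_i$ for $i=0,\ldots,k-2$. The shift map $\sigma_p:\mathbb{Z}_p\to\mathbb{Z}_p$ is $\sigma_p(n)=(n-d)/p$ where $d\in\{0,\ldots,p-1\}$, $d\equiv n\pmod p$; $B(\mathbb{Z}_p)$ is the graph with vertex set $\mathbb{Z}_p$ and edges $n\to\sigma_p(n)$. -}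

module Defs where

open import Data.Nat as ℕ using (ℕ; zero; suc; _<_; NonZero)
open import Data.Nat.Properties using (m^n≢0)
open import Data.Integer as ℤ using (ℤ; +_; _/ℕ_; _%ℕ_)
open import Data.Product using (Σ; _×_)
open import Function.Bundles using (_⇔_)
open import Relation.Binary.PropositionalEquality using (_≡_)

sumBelow : ℕ → (ℕ → ℕ) → ℕ
sumBelow zero    g = 0
sumBelow (suc k) g = sumBelow k g ℕ.+ g k

iter : {A : Set} → ℕ → (A → A) → A → A
iter zero    h x = x
iter (suc j) h x = h (iter j h x)

module _ (p : ℕ) .{{_ : NonZero p}} (a b : ℕ → ℤ) where

  fInt : ℤ → ℤ
  fInt n = let i = n %ℕ p in (a i ℤ.* n ℤ.+ b i) /ℕ p

  x : ℕ → ℤ → ℕ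
  x i n = iter i fInt n %ℕ p

  Φk : ℕ → ℕ → ℕ
  Φk k n = sumBelow k (λ i → x i (+ n) ℕ.* p ℕ.^ i)

  CEdge : ℕ → ℕ → ℕ → Set
  CEdge k u v = Σ ℤ λ u₁ → Σ ℤ λ v₁ →
    ((u₁ %ℕ (p ℕ.^ k)) {{m^n≢0 p k}} ≡ u) ×
    ((v₁ %ℕ (p ℕ.^ k)) {{m^n≢0 p k}} ≡ v) × (fInt u₁ ≡ v₁)

module _ (p : ℕ) .{{_ : NonZero p}} where

  digit : ℕ → ℕ → ℕ
  digit j m = ((m ℕ./ (p ℕ.^ j)) {{m^n≢0 p j}}) ℕ.% p

  BEdge : ℕ → ℕ → ℕ → Set
  BEdge k u v = ∀ i → suc i < k → digit (suc i) u ≡ digit i v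

IsIsoBelow : ℕ → (ℕ → ℕ) → (ℕ → ℕ → Set) → (ℕ → ℕ → Set) → Set
IsIsoBelow N φ E E' =
  (∀ n → n < N → φ n < N) ×
  (∀ n m → n < N → m < N → φ n ≡ φ m → n ≡ m) ×
  (∀ m → m < N → Σ ℕ λ n → n < N × φ n ≡ m) ×
  (∀ u v → u < N → v < N → (E u v ⇔ E' (φ u) (φ v)))

IsomorphicBelow : ℕ → (ℕ → ℕ → Set) → (ℕ → ℕ → Set) → Set
IsomorphicBelow N E E' = Σ (ℕ → ℕ) λ φ → IsIsoBelow N φ E E'

-- p-adic integers ℤ_p as the inverse limit of ℤ/p^kℤ:
-- a compatible sequence of residues r k ∈ {0,…,p^k-1} with
-- r (k+1) ≡ r k (mod p^k).
Seq : Set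
Seq = ℕ → ℕ

module _ (p : ℕ) .{{_ : NonZero p}} where

  IsZp : Seq → Set
  IsZp r = (∀ k → r k < p ℕ.^ k) ×
           (∀ k → (r (suc k) ℕ.% (p ℕ.^ k)) {{m^n≢0 p k}} ≡ r k)

  _≈_ : Seq → Seq → Set
  r ≈ s = ∀ k → r k ≡ s k

  -- shift map σ_p(n) = (n - d)/p, level-wise
  σ : Seq → Seq
  σ r k = r (suc k) ℕ./ p

  IsIsoZp : (Seq → Seq) → (Seq → Seq → Set) → (Seq → Seq → Set) → Set
  IsIsoZp φ E E' =
    (∀ r → IsZp r → IsZp (φ r)) ×
    (∀ r s → IsZp r → IsZp s → r ≈ s → φ r ≈ φ s) ×
    (∀ r s → IsZp r → IsZp s → φ r ≈ φ s → r ≈ s) ×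
    (∀ s → IsZp s → Σ Seq λ r → IsZp r × φ r ≈ s) ×
    (∀ r s → IsZp r → IsZp s → (E r s ⇔ E' (φ r) (φ s)))

  IsomorphicZp : (Seq → Seq → Set) → (Seq → Seq → Set) → Set
  IsomorphicZp E E' = Σ (Seq → Seq) λ φ → IsIsoZp φ E E'

  BEdgeZp : Seq → Seq → Set
  BEdgeZp r s = s ≈ σ r

module _ (p : ℕ) .{{_ : NonZero p}} (a b : ℕ → ℤ) where

  fZp : Seq → Seq
  fZp r k = let i = r 1 in
    ((a i ℤ.* + r (suc k) ℤ.+ b i) /ℕ p %ℕ (p ℕ.^ k)) {{m^n≢0 p k}}

  xZp : ℕ → Seq → ℕ
  xZp i r = iter i fZp r 1

  -- Φ_p(n) = Σ_{i≥0} x_i(n) p^i ; its residue mod p^k is the partial sum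
  ΦZp : Seq → Seq
  ΦZp r k = sumBelow k (λ i → xZp i r ℕ.* p ℕ.^ i)

  CEdgeZp : Seq → Seq → Set
  CEdgeZp r s = _≈_ p s (fZp r)

module Submission where

-- For n ∈ ℤ let x_i(n) = f^i(n) mod p be its orbit digits and Φ_k(n) = Σ_{i<k} x_i(n) p^i.
-- Everything rests on one arithmetic fact: because every slope a_i is a unit mod p,
--     n ≡ m (mod p^j)   ⇔   x_i(n) = x_i(m) for all i < j          (congruence⇔orbit-digits),
-- proved by induction on j from "f maps congruence mod p^{j+1} to congruence mod p^j" (f-cong)
-- and its converse one level down (f-cancel).  Hence Φ_k is injective on {0,…,p^k-1}, and so
-- bijective by pigeonhole.  Adjacency of Φ_k(u), Φ_k(v) in B(p,k) says that the digits of f(u)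
-- are those of v, i.e. f u ≡ v (mod p^{k-1}); a Hensel-type lifting (f-lift, which uses that
-- a_i t ≡ c (mod p) is solvable) shows this is exactly adjacency of u, v in C^{(f)}(p,k).
-- A p-adic integer is a compatible sequence of residues, and level K of Φ_p(r) is Φ_K applied
-- to level K of r (Φₚ-level); so the finite results yield the isomorphism on ℤ_p, and the
-- conjugacy Φ_p ∘ f = σ_p ∘ Φ_p says that the digits of f(r) are those of r shifted by one.

open import Defs
open import Data.Nat as Nat using (ℕ; zero; suc; NonZero; _<_; _≤_; z≤n; s≤s; _^_; _%_; _/_; _∸_)
import Data.Nat.Properties as ℕP
import Data.Nat.DivMod as ℕD
import Data.Nat.Divisibility as ℕ∣
open import Data.Nat.Coprimality as Coprimality using (Coprime)
open import Data.Nat.GCD using (gcd)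
import Algebra.Properties.CommutativeSemigroup ℕP.*-commutativeSemigroup as ℕ*
open import Data.Fin as Fin using (Fin; toℕ; fromℕ<; punchOut)
import Data.Fin.Properties as FinP
open import Data.Integer as Int using (ℤ; +_; -_; _-_; _%ℕ_; _/ℕ_; ∣_∣)
import Data.Integer.Properties as ℤP
import Data.Integer.DivMod as ℤD
open import Data.Integer.Divisibility using () renaming (_∣_ to _∣ᵤ_)
open import Data.Integer.Divisibility.Signed as ℤ∣ using (_∣_; divides)
open import Data.Integer.Tactic.RingSolver using (solve-∀)
open import Data.Product using (Σ; _×_; _,_; proj₁; proj₂)
open import Data.Sum using (inj₁; inj₂)
open import Data.Empty using (⊥-elim)
open import Function.Bundles using (_⇔_; mk⇔)
import Function.Properties.Equivalence as ⇔
open import Relation.Nullary using (yes; no)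
open import Relation.Binary.PropositionalEquality

module _ where
  open Nat using (_+_; _*_)

  sumBelow-cong : ∀ k {g h : ℕ → ℕ} → (∀ i → i < k → g i ≡ h i) → sumBelow k g ≡ sumBelow k h
  sumBelow-cong zero    eq = refl
  sumBelow-cong (suc k) eq =
    cong₂ _+_ (sumBelow-cong k (λ i i<k → eq i (ℕP.m<n⇒m<1+n i<k))) (eq k ℕP.≤-refl)

  sumBelow-head : ∀ k g → sumBelow (suc k) g ≡ g 0 + sumBelow k (λ i → g (suc i))
  sumBelow-head zero    g = ℕP.+-comm 0 (g 0)
  sumBelow-head (suc k) g = begin
    sumBelow (suc k) g + g (suc k)                         ≡⟨ cong (_+ g (suc k)) (sumBelow-head k g) ⟩
    g 0 + sumBelow k (λ i → g (suc i)) + g (suc k)         ≡⟨ ℕP.+-assoc (g 0) _ (g (suc k)) ⟩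
    g 0 + (sumBelow k (λ i → g (suc i)) + g (suc k))       ∎
    where open ≡-Reasoning

  sumBelow-*ˡ : ∀ m k g → sumBelow k (λ i → m * g i) ≡ m * sumBelow k g
  sumBelow-*ˡ m zero    g = sym (ℕP.*-zeroʳ m)
  sumBelow-*ˡ m (suc k) g = trans (cong (_+ m * g k) (sumBelow-*ˡ m k g))
                                  (sym (ℕP.*-distribˡ-+ m (sumBelow k g) (g k)))

module BaseExpansion (p : ℕ) .{{_ : NonZero p}} where
  open Nat using (_+_; _*_)

  p^≢0 : ∀ k → NonZero (p ^ k)
  p^≢0 k = ℕP.m^n≢0 p k

  Digits : (ℕ → ℕ) → Set
  Digits c = ∀ i → c i < p

  expand : ℕ → (ℕ → ℕ) → ℕ
  expand k c = sumBelow k (λ i → c i * p ^ i)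

  expand-cong : ∀ k {c d : ℕ → ℕ} → (∀ i → i < k → c i ≡ d i) → expand k c ≡ expand k d
  expand-cong k eq = sumBelow-cong k (λ i i<k → cong (_* p ^ i) (eq i i<k))

  expand-unfold : ∀ k c → expand (suc k) c ≡ c 0 + p * expand k (λ i → c (suc i))
  expand-unfold k c = trans (sumBelow-head k (λ i → c i * p ^ i))
    (cong₂ _+_ (ℕP.*-identityʳ (c 0))
      (trans (sumBelow-cong k (λ i _ → ℕ*.x∙yz≈y∙xz (c (suc i)) p (p ^ i)))
             (sumBelow-*ˡ p k (λ i → c (suc i) * p ^ i))))

  expand-< : ∀ k c → Digits c → expand k c < p ^ k
  expand-< zero    c digits = s≤s z≤n
  expand-< (suc k) c digits = begin-strict
    expand (suc k) c    ≡⟨ expand-unfold k c ⟩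
    c 0 + p * E         <⟨ ℕP.+-monoˡ-< (p * E) (digits 0) ⟩
    p + p * E           ≡⟨ ℕP.*-suc p E ⟨
    p * suc E           ≤⟨ ℕP.*-monoʳ-≤ p (expand-< k (λ i → c (suc i)) (λ i → digits (suc i))) ⟩
    p * p ^ k           ∎
    where
    open ℕP.≤-Reasoning
    E = expand k (λ i → c (suc i))

  expand-%-truncate : ∀ k c → Digits c → (expand (suc k) c % p ^ k) {{p^≢0 k}} ≡ expand k c
  expand-%-truncate k c digits =
    trans (ℕD.[m+kn]%n≡m%n (expand k c) (c k) (p ^ k) {{p^≢0 k}})
          (ℕD.m<n⇒m%n≡m {{p^≢0 k}} (expand-< k c digits))

  expand-%-p : ∀ k c → c 0 < p → expand (suc k) c % p ≡ c 0
  expand-%-p k c c₀<p = begin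
    expand (suc k) c % p             ≡⟨ cong (_% p) (expand-unfold k c) ⟩
    (c 0 + p * E) % p                ≡⟨ ℕD.%-remove-+ʳ (c 0) (ℕ∣.m∣m*n E) ⟩
    c 0 % p                          ≡⟨ ℕD.m<n⇒m%n≡m c₀<p ⟩
    c 0                              ∎
    where
    open ≡-Reasoning
    E = expand k (λ i → c (suc i))

  expand-/-p : ∀ k c → c 0 < p → expand (suc k) c / p ≡ expand k (λ i → c (suc i))
  expand-/-p k c c₀<p = begin
    expand (suc k) c / p             ≡⟨ cong (_/ p) (expand-unfold k c) ⟩
    (c 0 + p * E) / p                ≡⟨ ℕD.+-distrib-/-∣ʳ (c 0) (ℕ∣.m∣m*n E) ⟩
    c 0 / p + p * E / p              ≡⟨ cong₂ _+_ (ℕD.m<n⇒m/n≡0 c₀<p) (trans (cong (_/ p) (ℕP.*-comm p E))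
                                                                        (ℕD.m*n/n≡m E p)) ⟩
    E                                ∎
    where
    open ≡-Reasoning
    E = expand k (λ i → c (suc i))

  digit-expand : ∀ k c → Digits c → ∀ j → j < k → digit p j (expand k c) ≡ c j
  digit-expand (suc k) c digits zero    _         =
    trans (cong (_% p) (ℕD.n/1≡n _)) (expand-%-p k c (digits 0))
  digit-expand (suc k) c digits (suc j) (s≤s j<k) = begin
    digit p (suc j) (expand (suc k) c)
      ≡⟨ cong (_% p) (ℕD.m/n/o≡m/[n*o] _ p (p ^ j) {{_}} {{p^≢0 j}} {{p^≢0 (suc j)}}) ⟨
    digit p j (expand (suc k) c / p)         ≡⟨ cong (digit p j) (expand-/-p k c (digits 0)) ⟩
    digit p j (expand k (λ i → c (suc i)))
      ≡⟨ digit-expand k (λ i → c (suc i)) (λ i → digits (suc i)) j j<k ⟩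
    c (suc j)                                ∎
    where open ≡-Reasoning

Fin-injective⇒surjective : ∀ {n} (g : Fin n → Fin n) → (∀ {i j} → g i ≡ g j → i ≡ j) →
                           ∀ y → Σ (Fin n) λ i → g i ≡ y
Fin-injective⇒surjective {zero}  g g-injective ()
Fin-injective⇒surjective {suc n} g g-injective y with FinP.any? (λ i → g i Fin.≟ y)
... | yes found   = found
... | no y∉image = ⊥-elim (ℕP.1+n≰n (FinP.injective⇒≤ punched-injective))
  where
  -- g misses y, so deleting y from the codomain leaves an injection Fin (n+1) → Fin n
  missed : ∀ i → y ≢ g i
  missed i y≡gi = y∉image (i , sym y≡gi)
  punched : Fin (suc n) → Fin n
  punched i = punchOut (missed i)
  punched-injective : ∀ {i j} → punched i ≡ punched j → i ≡ j
  punched-injective {i} {j} eq = g-injective (FinP.punchOut-injective (missed i) (missed j) eq)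

injective⇒surjective : ∀ N (φ : ℕ → ℕ) → (∀ n → n < N → φ n < N) →
  (∀ n m → n < N → m < N → φ n ≡ φ m → n ≡ m) →
  ∀ m → m < N → Σ ℕ λ n → n < N × φ n ≡ m
injective⇒surjective N φ into φ-injective m m<N =
  toℕ i , FinP.toℕ<n i , trans (sym (toℕ-φ̂ i)) (trans (cong toℕ φ̂i≡m) (FinP.toℕ-fromℕ< m<N))
  where
  φ̂ : Fin N → Fin N
  φ̂ i = fromℕ< (into (toℕ i) (FinP.toℕ<n i))
  toℕ-φ̂ : ∀ i → toℕ (φ̂ i) ≡ φ (toℕ i)
  toℕ-φ̂ i = FinP.toℕ-fromℕ< (into (toℕ i) (FinP.toℕ<n i))
  φ̂-injective : ∀ {i j} → φ̂ i ≡ φ̂ j → i ≡ j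
  φ̂-injective {i} {j} eq = FinP.toℕ-injective (φ-injective (toℕ i) (toℕ j) (FinP.toℕ<n i) (FinP.toℕ<n j)
    (trans (sym (toℕ-φ̂ i)) (trans (cong toℕ eq) (toℕ-φ̂ j))))
  preimage : Σ (Fin N) λ i → φ̂ i ≡ fromℕ< m<N
  preimage = Fin-injective⇒surjective φ̂ φ̂-injective (fromℕ< m<N)
  i : Fin N
  i = proj₁ preimage
  φ̂i≡m : φ̂ i ≡ fromℕ< m<N
  φ̂i≡m = proj₂ preimage

-- From here on, + and * are the integer operations (natural-number arithmetic is written Nat.+, Nat.*).
open Int using (_+_; _*_)

infix 4 _≡_mod_
record _≡_mod_ (x y : ℤ) (n : ℕ) : Set where
  constructor modular
  field n∣x-y : + n ∣ x - y
open _≡_mod_ public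

≡-refl : ∀ {n} x → x ≡ x mod n
≡-refl x = modular (divides Int.0ℤ (ℤP.+-inverseʳ x))

≡-sym : ∀ {n x y} → x ≡ y mod n → y ≡ x mod n
≡-sym {n} {x} {y} (modular n∣x-y) = modular (subst (+ n ∣_) (negate x y) (ℤ∣.∣m⇒∣-m n∣x-y))
  where
  negate : ∀ x y → - (x - y) ≡ y - x
  negate = solve-∀

≡-trans : ∀ {n x y z} → x ≡ y mod n → y ≡ z mod n → x ≡ z mod n
≡-trans {n} {x} {y} {z} (modular n∣x-y) (modular n∣y-z) =
  modular (subst (+ n ∣_) (telescope x y z) (ℤ∣.∣m∣n⇒∣m+n n∣x-y n∣y-z))
  where
  telescope : ∀ x y z → (x - y) + (y - z) ≡ x - z
  telescope = solve-∀

≡-factorˡ : ∀ {m n x y} → x ≡ y mod m Nat.* n → x ≡ y mod m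
≡-factorˡ {m} {n} (modular mn∣x-y) = modular (ℤ∣.∣-trans (ℤ∣.∣ᵤ⇒∣ (ℕ∣.m∣m*n n)) mn∣x-y)

≡-factorʳ : ∀ {m n x y} → x ≡ y mod m Nat.* n → x ≡ y mod n
≡-factorʳ {m} {n} (modular mn∣x-y) = modular (ℤ∣.∣-trans (ℤ∣.∣ᵤ⇒∣ (ℕ∣.n∣m*n m)) mn∣x-y)

≡-%ℕ : ∀ n .{{_ : NonZero n}} x → x ≡ + (x %ℕ n) mod n
≡-%ℕ n x = modular (divides (x /ℕ n) (begin
  x - + (x %ℕ n)                           ≡⟨ cong (_- + (x %ℕ n)) (ℤD.a≡a%ℕn+[a/ℕn]*n x n) ⟩
  + (x %ℕ n) + x /ℕ n * + n - + (x %ℕ n)   ≡⟨ cancel (+ (x %ℕ n)) (x /ℕ n * + n) ⟩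
  x /ℕ n * + n                             ∎))
  where
  open ≡-Reasoning
  cancel : ∀ r q → r + q - r ≡ q
  cancel = solve-∀

≡-residue-≤ : ∀ {n r s} .{{_ : NonZero n}} → s ≤ r → r < n → + r ≡ + s mod n → r ≡ s
≡-residue-≤ {n} {r} {s} s≤r r<n (modular n∣r-s) = ℕP.≤-antisym (ℕP.m∸n≡0⇒m≤n r∸s≡0) s≤r
  where
  n∣r∸s : n ℕ∣.∣ r ∸ s
  n∣r∸s = subst (λ d → n ℕ∣.∣ ∣ d ∣) (trans (ℤP.[+m]-[+n]≡m⊖n r s) (ℤP.⊖-≥ s≤r))
                (ℤ∣.∣⇒∣ᵤ n∣r-s)
  r∸s≡0 : r ∸ s ≡ 0
  r∸s≡0 = trans (sym (ℕD.m<n⇒m%n≡m (ℕP.≤-<-trans (ℕP.m∸n≤m r s) r<n)))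
                (ℕ∣.n∣m⇒m%n≡0 _ n n∣r∸s)

≡-residue : ∀ {n r s} .{{_ : NonZero n}} → r < n → s < n → + r ≡ + s mod n → r ≡ s
≡-residue {r = r} {s} r<n s<n r≡s with ℕP.≤-total s r
... | inj₁ s≤r = ≡-residue-≤ s≤r r<n r≡s
... | inj₂ r≤s = sym (≡-residue-≤ r≤s s<n (≡-sym r≡s))

≡⇒%ℕ-≡ : ∀ n .{{_ : NonZero n}} {x y} → x ≡ y mod n → x %ℕ n ≡ y %ℕ n
≡⇒%ℕ-≡ n {x} {y} x≡y = ≡-residue (ℤD.n%ℕd<d x n) (ℤD.n%ℕd<d y n)
  (≡-trans (≡-sym (≡-%ℕ n x)) (≡-trans x≡y (≡-%ℕ n y)))

%ℕ-≡⇒≡ : ∀ n .{{_ : NonZero n}} {x y} → x %ℕ n ≡ y %ℕ n → x ≡ y mod n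
%ℕ-≡⇒≡ n {x} {y} eq = ≡-trans (≡-%ℕ n x) (subst (λ r → + r ≡ y mod n) (sym eq) (≡-sym (≡-%ℕ n y)))

exact-division : ∀ n .{{_ : NonZero n}} {z} → + n ∣ z → (z /ℕ n) * + n ≡ z
exact-division n {z} n∣z = sym (begin
  z                              ≡⟨ ℤD.a≡a%ℕn+[a/ℕn]*n z n ⟩
  + (z %ℕ n) + (z /ℕ n) * + n    ≡⟨ cong (λ r → + r + (z /ℕ n) * + n) z%n≡0 ⟩
  + 0 + (z /ℕ n) * + n           ≡⟨ ℤP.+-identityˡ _ ⟩
  (z /ℕ n) * + n                 ∎)
  where
  open ≡-Reasoning
  z≡0 : z ≡ Int.0ℤ mod n
  z≡0 = modular (subst (+ n ∣_) (sym (ℤP.+-identityʳ z)) n∣z)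
  z%n≡0 : z %ℕ n ≡ 0
  z%n≡0 = trans (≡⇒%ℕ-≡ n z≡0) (ℕ∣.n∣m⇒m%n≡0 0 n (n ℕ∣.∣0))

%ℕ-congʳ : ∀ x {m n} .{{_ : NonZero m}} .{{_ : NonZero n}} → m ≡ n → x %ℕ m ≡ x %ℕ n
%ℕ-congʳ x refl = refl

unit-cancel : ∀ {n A y z} → Coprime n ∣ A ∣ → A * y ≡ A * z mod n → y ≡ z mod n
unit-cancel {n} {A} {y} {z} n⊥A (modular n∣Ay-Az) =
  modular (ℤ∣.∣ᵤ⇒∣ (Coprimality.coprime-divisor n⊥A n∣∣A∣∣y-z∣))
  where
  factor : ∀ A y z → A * y - A * z ≡ A * (y - z)
  factor = solve-∀
  n∣∣A∣∣y-z∣ : n ℕ∣.∣ ∣ A ∣ Nat.* ∣ y - z ∣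
  n∣∣A∣∣y-z∣ = subst (n ℕ∣.∣_) (trans (cong ∣_∣ (factor A y z)) (ℤP.abs-* A (y - z)))
                     (ℤ∣.∣⇒∣ᵤ n∣Ay-Az)

-- hence t ↦ A t permutes the residues mod n, and A t ≡ c (mod n) is solvable
unit-solve : ∀ {n A} .{{_ : NonZero n}} → Coprime n ∣ A ∣ → ∀ c → Σ ℤ λ t → A * t ≡ c mod n
unit-solve {n} {A} n⊥A c = + t , %ℕ-≡⇒≡ n At≡c
  where
  times-A : ℕ → ℕ
  times-A t = (A * + t) %ℕ n
  times-A-injective : ∀ t t' → t < n → t' < n → times-A t ≡ times-A t' → t ≡ t'
  times-A-injective t t' t<n t'<n eq = ≡-residue t<n t'<n (unit-cancel {A = A} n⊥A (%ℕ-≡⇒≡ n eq))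
  preimage : Σ ℕ λ t → t < n × times-A t ≡ c %ℕ n
  preimage = injective⇒surjective n times-A (λ t _ → ℤD.n%ℕd<d (A * + t) n) times-A-injective
               (c %ℕ n) (ℤD.n%ℕd<d c n)
  t : ℕ
  t = proj₁ preimage
  At≡c : times-A t ≡ c %ℕ n
  At≡c = proj₂ (proj₂ preimage)

iter-suc : ∀ {A : Set} i (h : A → A) x → iter (suc i) h x ≡ iter i h (h x)
iter-suc zero    h x = refl
iter-suc (suc i) h x = cong h (iter-suc i h x)

iter-preserves : ∀ {A : Set} (P : A → Set) (h : A → A) → (∀ x → P x → P (h x)) →
                 ∀ i x → P x → P (iter i h x)
iter-preserves P h h-pres zero    x Px = Px
iter-preserves P h h-pres (suc i) x Px = h-pres _ (iter-preserves P h h-pres i x Px)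

coprime-^-divisor : ∀ {p A} .{{_ : NonZero p}} → Coprime p A →
                    ∀ k d → p ^ k ℕ∣.∣ A Nat.* d → p ^ k ℕ∣.∣ d
coprime-^-divisor p⊥A zero    d _ = ℕ∣.1∣ d
coprime-^-divisor {p} {A} p⊥A (suc k) d pᵏ⁺¹∣Ad
  with Coprimality.coprime-divisor p⊥A (ℕ∣.∣-trans (ℕ∣.m∣m*n (p ^ k)) pᵏ⁺¹∣Ad)
... | ℕ∣.divides q refl = subst (p Nat.* p ^ k ℕ∣.∣_) (ℕP.*-comm p q)
        (ℕ∣.*-monoʳ-∣ p (coprime-^-divisor p⊥A k q (ℕ∣.*-cancelˡ-∣ p pᵏ⁺¹∣pAq)))
  where
  pᵏ⁺¹∣pAq : p Nat.* p ^ k ℕ∣.∣ p Nat.* (A Nat.* q)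
  pᵏ⁺¹∣pAq = subst (p Nat.* p ^ k ℕ∣.∣_) (ℕ*.x∙yz≈z∙xy A q p) pᵏ⁺¹∣Ad

module AffineMap (p : ℕ) .{{_ : NonZero p}} (a b : ℕ → ℤ)
  (p∣ia+b : ∀ i → i < p → + p ∣ᵤ (+ i * a i + b i)) where

  open BaseExpansion p

  f : ℤ → ℤ
  f = fInt p a b

  branch : ℤ → ℕ
  branch n = n %ℕ p

  branch-cong : ∀ {n m} → n ≡ m mod p → branch m ≡ branch n
  branch-cong n≡m = sym (≡⇒%ℕ-≡ p n≡m)

  -- each branch value a_i n + b_i is a multiple of p, so the division defining f is exact;
  -- moreover any m ≡ n (mod p) may be evaluated with the branch of n
  f-exact : ∀ {n m} → n ≡ m mod p → f m * + p ≡ a (branch n) * m + b (branch n)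
  f-exact {n} {m} n≡m = begin
    f m * + p                         ≡⟨ exact-division p p∣branch ⟩
    a (branch m) * m + b (branch m)   ≡⟨ cong (λ i → a i * m + b i) (branch-cong n≡m) ⟩
    a (branch n) * m + b (branch n)   ∎
    where
    open ≡-Reasoning
    i = branch m
    -- a_i m + b_i = a_i (m - i) + (i a_i + b_i), and p divides both summands
    split : ∀ A m I B → A * m + B ≡ A * (m - I) + (I * A + B)
    split = solve-∀
    p∣branch : + p ∣ a i * m + b i
    p∣branch = subst (+ p ∣_) (sym (split (a i) m (+ i) (b i)))
      (ℤ∣.∣m∣n⇒∣m+n (ℤ∣.∣n⇒∣m*n (a i) (n∣x-y (≡-%ℕ p m)))
                    (ℤ∣.∣ᵤ⇒∣ (p∣ia+b i (ℤD.n%ℕd<d m p))))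

  f-difference : ∀ {n m} → n ≡ m mod p → + p * (f n - f m) ≡ a (branch n) * (n - m)
  f-difference {n} {m} n≡m = begin
    + p * (f n - f m)                               ≡⟨ distrib (+ p) (f n) (f m) ⟩
    f n * + p - f m * + p                           ≡⟨ cong₂ _-_ (f-exact (≡-refl n)) (f-exact n≡m) ⟩
    (a i * n + b i) - (a i * m + b i)               ≡⟨ cancel (a i) n m (b i) ⟩
    a i * (n - m)                                   ∎
    where
    open ≡-Reasoning
    i = branch n
    distrib : ∀ P x y → P * (x - y) ≡ x * P - y * P
    distrib = solve-∀
    cancel : ∀ A n m B → (A * n + B) - (A * m + B) ≡ A * (n - m)
    cancel = solve-∀

  f-cong : ∀ N {n m} → n ≡ m mod p Nat.* N → f n ≡ f m mod N
  f-cong N {n} {m} n≡m = modular (ℤ∣.*-cancelˡ-∣ (+ p) pN∣p[fn-fm])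
    where
    pN∣p[fn-fm] : + p * + N ∣ + p * (f n - f m)
    pN∣p[fn-fm] = subst₂ _∣_ (ℤP.pos-* p N) (sym (f-difference (≡-factorˡ n≡m)))
      (ℤ∣.∣n⇒∣m*n (a (branch n)) (n∣x-y n≡m))

  orbit-digit : ℕ → ℤ → ℕ
  orbit-digit = x p a b

  orbit-digit-suc : ∀ i n → orbit-digit (suc i) n ≡ orbit-digit i (f n)
  orbit-digit-suc i n = cong (_%ℕ p) (iter-suc i f n)

  orbit-digit-< : ∀ i n → orbit-digit i n < p
  orbit-digit-< i n = ℤD.n%ℕd<d (iter i f n) p

  orbit-digit-cong : ∀ j {n m} → n ≡ m mod p ^ j → ∀ i → i < j → orbit-digit i n ≡ orbit-digit i m
  orbit-digit-cong (suc j) n≡m zero    _         = ≡⇒%ℕ-≡ p (≡-factorˡ n≡m)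
  orbit-digit-cong (suc j) {n} {m} n≡m (suc i) (s≤s i<j) = begin
    orbit-digit (suc i) n   ≡⟨ orbit-digit-suc i n ⟩
    orbit-digit i (f n)     ≡⟨ orbit-digit-cong j (f-cong (p ^ j) n≡m) i i<j ⟩
    orbit-digit i (f m)     ≡⟨ orbit-digit-suc i m ⟨
    orbit-digit (suc i) m   ∎
    where open ≡-Reasoning

  Φ : ℕ → ℕ → ℕ
  Φ = Φk p a b

  Φ-< : ∀ k n → Φ k n < p ^ k
  Φ-< k n = expand-< k (λ i → orbit-digit i (+ n)) (λ i → orbit-digit-< i (+ n))

  Φ-digit : ∀ k n i → i < k → digit p i (Φ k n) ≡ orbit-digit i (+ n)
  Φ-digit k n = digit-expand k (λ i → orbit-digit i (+ n)) (λ i → orbit-digit-< i (+ n))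

  Φ-% : ∀ k m → Φ k ((m % p ^ k) {{p^≢0 k}}) ≡ Φ k m
  Φ-% k m = expand-cong k (orbit-digit-cong k (≡-sym (≡-%ℕ (p ^ k) {{p^≢0 k}} (+ m))))

  Φ-BEdge : ∀ k u v → BEdge p (suc k) (Φ (suc k) u) (Φ (suc k) v) ⇔
                      (∀ i → i < k → orbit-digit i (f (+ u)) ≡ orbit-digit i (+ v))
  Φ-BEdge k u v = mk⇔ to (λ shifted i i<k → from shifted i (ℕP.≤-pred i<k))
    where
    open ≡-Reasoning
    to : BEdge p (suc k) (Φ (suc k) u) (Φ (suc k) v) →
         ∀ i → i < k → orbit-digit i (f (+ u)) ≡ orbit-digit i (+ v)
    to edge i i<k = begin
      orbit-digit i (f (+ u))                ≡⟨ orbit-digit-suc i (+ u) ⟨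
      orbit-digit (suc i) (+ u)              ≡⟨ Φ-digit (suc k) u (suc i) (s≤s i<k) ⟨
      digit p (suc i) (Φ (suc k) u)          ≡⟨ edge i (s≤s i<k) ⟩
      digit p i (Φ (suc k) v)                ≡⟨ Φ-digit (suc k) v i (ℕP.m<n⇒m<1+n i<k) ⟩
      orbit-digit i (+ v)                    ∎
    from : (∀ i → i < k → orbit-digit i (f (+ u)) ≡ orbit-digit i (+ v)) →
           ∀ i → i < k → digit p (suc i) (Φ (suc k) u) ≡ digit p i (Φ (suc k) v)
    from shifted i i<k = begin
      digit p (suc i) (Φ (suc k) u)          ≡⟨ Φ-digit (suc k) u (suc i) (s≤s i<k) ⟩
      orbit-digit (suc i) (+ u)              ≡⟨ orbit-digit-suc i (+ u) ⟩
      orbit-digit i (f (+ u))                ≡⟨ shifted i i<k ⟩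
      orbit-digit i (+ v)                    ≡⟨ Φ-digit (suc k) v i (ℕP.m<n⇒m<1+n i<k) ⟨
      digit p i (Φ (suc k) v)                ∎

  module Invertible (a⊥p : ∀ i → i < p → gcd ∣ a i ∣ p ≡ 1) where

    p⊥a : ∀ n → Coprime p ∣ a (branch n) ∣
    p⊥a n = Coprimality.sym (Coprimality.gcd≡1⇒coprime (a⊥p (branch n) (ℤD.n%ℕd<d n p)))

    f-cancel : ∀ j {n m} → n ≡ m mod p → f n ≡ f m mod p ^ j → n ≡ m mod p ^ suc j
    f-cancel j {n} {m} n≡m (modular pʲ∣fn-fm) =
      modular (ℤ∣.∣ᵤ⇒∣ (coprime-^-divisor (p⊥a n) (suc j) ∣ n - m ∣ pʲ⁺¹∣∣a∣∣n-m∣))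
      where
      pʲ⁺¹∣a[n-m] : + p * + (p ^ j) ∣ a (branch n) * (n - m)
      pʲ⁺¹∣a[n-m] = subst (+ p * + (p ^ j) ∣_) (f-difference n≡m) (ℤ∣.*-monoʳ-∣ (+ p) pʲ∣fn-fm)
      pʲ⁺¹∣∣a∣∣n-m∣ : p ^ suc j ℕ∣.∣ ∣ a (branch n) ∣ Nat.* ∣ n - m ∣
      pʲ⁺¹∣∣a∣∣n-m∣ = subst₂ ℕ∣._∣_ (ℤP.abs-* (+ p) (+ (p ^ j)))
                                   (ℤP.abs-* (a (branch n)) (n - m))
                                   (ℤ∣.∣⇒∣ᵤ pʲ⁺¹∣a[n-m])

    orbit-digits-determine : ∀ j {n m} → (∀ i → i < j → orbit-digit i n ≡ orbit-digit i m) →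
                             n ≡ m mod p ^ j
    orbit-digits-determine zero    _    = modular (ℤ∣.∣ᵤ⇒∣ (ℕ∣.1∣ _))
    orbit-digits-determine (suc j) {n} {m} same = f-cancel j (%ℕ-≡⇒≡ p (same 0 (s≤s z≤n)))
      (orbit-digits-determine j λ i i<j → begin
        orbit-digit i (f n)       ≡⟨ orbit-digit-suc i n ⟨
        orbit-digit (suc i) n     ≡⟨ same (suc i) (s≤s i<j) ⟩
        orbit-digit (suc i) m     ≡⟨ orbit-digit-suc i m ⟩
        orbit-digit i (f m)       ∎)
      where open ≡-Reasoning

    congruence⇔orbit-digits : ∀ j {n m} →
                              n ≡ m mod p ^ j ⇔ (∀ i → i < j → orbit-digit i n ≡ orbit-digit i m)
    congruence⇔orbit-digits j = mk⇔ (orbit-digit-cong j) (orbit-digits-determine j)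

    Φ-injective : ∀ k n m → n < p ^ k → m < p ^ k → Φ k n ≡ Φ k m → n ≡ m
    Φ-injective k n m n<pᵏ m<pᵏ Φn≡Φm = ≡-residue {{p^≢0 k}} n<pᵏ m<pᵏ
      (orbit-digits-determine k λ i i<k →
        trans (sym (Φ-digit k n i i<k)) (trans (cong (digit p i) Φn≡Φm) (Φ-digit k m i i<k)))

    Φ-surjective : ∀ k m → m < p ^ k → Σ ℕ λ n → n < p ^ k × Φ k n ≡ m
    Φ-surjective k = injective⇒surjective (p ^ k) (Φ k) (λ n _ → Φ-< k n) (Φ-injective k)

    f-shift : ∀ N n T → f (n + T * + (p Nat.* N)) ≡ f n + a (branch n) * T * + N
    f-shift N n T = ℤP.*-cancelʳ-≡ _ _ (+ p) (begin
      f (n + T * P) * + p                          ≡⟨ f-exact n≡shifted ⟩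
      a i * (n + T * P) + b i                      ≡⟨ cong (λ Q → a i * (n + T * Q) + b i) (ℤP.pos-* p N) ⟩
      a i * (n + T * (+ p * + N)) + b i            ≡⟨ expand-branch (a i) n T (+ p) (+ N) (b i) ⟩
      (a i * n + b i) + a i * T * + N * + p        ≡⟨ cong (_+ a i * T * + N * + p) (f-exact (≡-refl n)) ⟨
      f n * + p + a i * T * + N * + p              ≡⟨ ℤP.*-distribʳ-+ (+ p) (f n) (a i * T * + N) ⟨
      (f n + a i * T * + N) * + p                  ∎)
      where
      open ≡-Reasoning
      i = branch n
      P = + (p Nat.* N)
      n≡shifted : n ≡ n + T * P mod p
      n≡shifted = ≡-factorˡ (≡-sym (modular (divides T (cancel n (T * P)))))
        where
        cancel : ∀ n X → n + X - n ≡ X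
        cancel = solve-∀
      expand-branch : ∀ A n T P N B → A * (n + T * (P * N)) + B ≡ (A * n + B) + A * T * N * P
      expand-branch = solve-∀

    f-lift : ∀ k {u v} → f u ≡ v mod p ^ k →
             Σ ℤ λ u₁ → u₁ ≡ u mod p ^ suc k × f u₁ ≡ v mod p ^ suc k
    f-lift k {u} {v} (modular (divides c fu-v≡c·pᵏ)) =
      u₁ , modular (divides t (cancel u (t * P))) , modular (divides s fu₁-v≡s·pᵏ⁺¹)
      where
      open ≡-Reasoning
      i = branch u
      P = + (p ^ suc k)
      -- choose the correction t with a_i t ≡ -c (mod p), i.e. a_i t + c = s p
      correction : Σ ℤ λ t → a i * t ≡ - c mod p
      correction = unit-solve {A = a i} (p⊥a u) (- c)
      t = proj₁ correction
      s = ℤ∣._∣_.quotient (n∣x-y (proj₂ correction))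
      at+c≡s·p : a i * t - - c ≡ s * + p
      at+c≡s·p = ℤ∣._∣_.equality (n∣x-y (proj₂ correction))
      u₁ = u + t * P
      cancel : ∀ u X → u + X - u ≡ X
      cancel = solve-∀
      regroup : ∀ F v Y → F + Y - v ≡ (F - v) + Y
      regroup = solve-∀
      collect : ∀ c K Y → c * K + Y * K ≡ (Y - - c) * K
      collect = solve-∀
      fu₁-v≡s·pᵏ⁺¹ : f u₁ - v ≡ s * P
      fu₁-v≡s·pᵏ⁺¹ = begin
        f u₁ - v                              ≡⟨ cong (_- v) (f-shift (p ^ k) u t) ⟩
        f u + a i * t * + (p ^ k) - v         ≡⟨ regroup (f u) v (a i * t * + (p ^ k)) ⟩
        (f u - v) + a i * t * + (p ^ k)       ≡⟨ cong (_+ a i * t * + (p ^ k)) fu-v≡c·pᵏ ⟩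
        c * + (p ^ k) + a i * t * + (p ^ k)   ≡⟨ collect c (+ (p ^ k)) (a i * t) ⟩
        (a i * t - - c) * + (p ^ k)           ≡⟨ cong (_* + (p ^ k)) at+c≡s·p ⟩
        s * + p * + (p ^ k)                   ≡⟨ ℤP.*-assoc s (+ p) (+ (p ^ k)) ⟩
        s * (+ p * + (p ^ k))                 ≡⟨ cong (s *_) (ℤP.pos-* p (p ^ k)) ⟨
        s * P                                 ∎

    CEdge⇔f-congruence : ∀ k u v → u < p ^ suc k → v < p ^ suc k →
                          CEdge p a b (suc k) u v ⇔ f (+ u) ≡ + v mod p ^ k
    CEdge⇔f-congruence k u v u<pᵏ⁺¹ v<pᵏ⁺¹ = mk⇔ to from
      where
      reduced : ∀ {w} → w < p ^ suc k → ((+ w) %ℕ p ^ suc k) {{p^≢0 (suc k)}} ≡ w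
      reduced = ℕD.m<n⇒m%n≡m {{p^≢0 (suc k)}}
      to : CEdge p a b (suc k) u v → f (+ u) ≡ + v mod p ^ k
      to (u₁ , v₁ , u₁≡u , v₁≡v , fu₁≡v₁) =
        ≡-trans (f-cong (p ^ k) (≡-sym u₁≡+u))
                (subst (_≡ + v mod p ^ k) (sym fu₁≡v₁) (≡-factorʳ {p} v₁≡+v))
        where
        u₁≡+u : u₁ ≡ + u mod p ^ suc k
        u₁≡+u = %ℕ-≡⇒≡ (p ^ suc k) {{p^≢0 (suc k)}} (trans u₁≡u (sym (reduced u<pᵏ⁺¹)))
        v₁≡+v : v₁ ≡ + v mod p ^ suc k
        v₁≡+v = %ℕ-≡⇒≡ (p ^ suc k) {{p^≢0 (suc k)}} (trans v₁≡v (sym (reduced v<pᵏ⁺¹)))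
      from : f (+ u) ≡ + v mod p ^ k → CEdge p a b (suc k) u v
      from fu≡v = u₁ , f u₁ , trans (≡⇒%ℕ-≡ (p ^ suc k) {{p^≢0 (suc k)}} u₁≡u) (reduced u<pᵏ⁺¹) ,
                              trans (≡⇒%ℕ-≡ (p ^ suc k) {{p^≢0 (suc k)}} fu₁≡v) (reduced v<pᵏ⁺¹) , refl
        where
        lift : Σ ℤ λ u₁ → u₁ ≡ + u mod p ^ suc k × f u₁ ≡ + v mod p ^ suc k
        lift = f-lift k fu≡v
        u₁ = proj₁ lift
        u₁≡u = proj₁ (proj₂ lift)
        fu₁≡v = proj₂ (proj₂ lift)

    Φ-isomorphism : ∀ k → 1 ≤ k → IsIsoBelow (p ^ k) (Φ k) (CEdge p a b k) (BEdge p k)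
    Φ-isomorphism (suc k) _ = (λ n _ → Φ-< (suc k) n) , Φ-injective (suc k) , Φ-surjective (suc k) ,
      λ u v u<pᵏ⁺¹ v<pᵏ⁺¹ → ⇔.trans (CEdge⇔f-congruence k u v u<pᵏ⁺¹ v<pᵏ⁺¹)
                              (⇔.trans (congruence⇔orbit-digits k) (⇔.sym (Φ-BEdge k u v)))

module PAdic (p : ℕ) .{{_ : NonZero p}} (a b : ℕ → ℤ)
  (p∣ia+b : ∀ i → i < p → + p ∣ᵤ (+ i * a i + b i))
  (a⊥p : ∀ i → i < p → gcd ∣ a i ∣ p ≡ 1) where

  open BaseExpansion p
  open AffineMap p a b p∣ia+b
  open Invertible a⊥p

  fₚ : Seq → Seq
  fₚ = fZp p a b

  Φₚ : Seq → Seq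
  Φₚ = ΦZp p a b

  xₚ : ℕ → Seq → ℕ
  xₚ = xZp p a b

  level-% : ∀ {r} → IsZp p r → ∀ d j → (r (d Nat.+ j) % p ^ j) {{p^≢0 j}} ≡ r j
  level-% zr zero    j = ℕD.m<n⇒m%n≡m {{p^≢0 j}} (proj₁ zr j)
  level-% {r} zr (suc d) j = begin
    (r (suc d Nat.+ j) % p ^ j) {{p^≢0 j}}
      ≡⟨ ℕD.m∣n⇒o%n%m≡o%m (p ^ j) (p ^ (d Nat.+ j)) _ {{p^≢0 j}} {{p^≢0 (d Nat.+ j)}} pʲ∣pᵈ⁺ʲ ⟨
    ((r (suc d Nat.+ j) % p ^ (d Nat.+ j)) {{p^≢0 (d Nat.+ j)}} % p ^ j) {{p^≢0 j}}
      ≡⟨ cong (λ m → (m % p ^ j) {{p^≢0 j}}) (proj₂ zr (d Nat.+ j)) ⟩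
    (r (d Nat.+ j) % p ^ j) {{p^≢0 j}}
      ≡⟨ level-% zr d j ⟩
    r j ∎
    where
    open ≡-Reasoning
    pʲ∣pᵈ⁺ʲ : p ^ j ℕ∣.∣ p ^ (d Nat.+ j)
    pʲ∣pᵈ⁺ʲ = subst (p ^ j ℕ∣.∣_) (sym (ℕP.^-distribˡ-+-* p d j)) (ℕ∣.n∣m*n (p ^ d))

  level-≡ : ∀ {r} → IsZp p r → ∀ {j K} → j ≤ K → + r K ≡ + r j mod p ^ j
  level-≡ {r} zr {j} j≤K with ℕP.m≤n⇒∃[o]m+o≡n j≤K
  ... | d , refl = %ℕ-≡⇒≡ (p ^ j) {{p^≢0 j}} (begin
    (r (j Nat.+ d) % p ^ j) {{p^≢0 j}}   ≡⟨ cong (λ K → (r K % p ^ j) {{p^≢0 j}}) (ℕP.+-comm j d) ⟩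
    (r (d Nat.+ j) % p ^ j) {{p^≢0 j}}   ≡⟨ level-% zr d j ⟩
    r j                                  ≡⟨ ℕD.m<n⇒m%n≡m {{p^≢0 j}} (proj₁ zr j) ⟨
    (r j % p ^ j) {{p^≢0 j}}             ∎)
    where open ≡-Reasoning

  branch-level : ∀ {r} → IsZp p r → ∀ {K} → 1 ≤ K → branch (+ r K) ≡ r 1
  branch-level {r} zr 1≤K = trans (≡⇒%ℕ-≡ p (≡-factorˡ (level-≡ zr 1≤K)))
    (ℕD.m<n⇒m%n≡m (subst (r 1 <_) (ℕP.*-identityʳ p) (proj₁ zr 1)))

  fₚ-level : ∀ {r} → IsZp p r → ∀ k → fₚ r k ≡ (f (+ r (suc k)) %ℕ p ^ k) {{p^≢0 k}}
  fₚ-level {r} zr k = cong (λ i → (((a i * + r (suc k) + b i) /ℕ p) %ℕ p ^ k) {{p^≢0 k}})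
                           (sym (branch-level zr (s≤s z≤n)))

  fₚ-IsZp : ∀ r → IsZp p r → IsZp p (fₚ r)
  fₚ-IsZp r zr = (λ k → ℤD.n%ℕd<d ((a (r 1) * + r (suc k) + b (r 1)) /ℕ p) (p ^ k) {{p^≢0 k}}) , compatible
    where
    open ≡-Reasoning
    compatible : ∀ k → (fₚ r (suc k) % p ^ k) {{p^≢0 k}} ≡ fₚ r k
    compatible k = begin
      (fₚ r (suc k) % p ^ k) {{p^≢0 k}}
        ≡⟨ cong (λ m → (m % p ^ k) {{p^≢0 k}}) (fₚ-level zr (suc k)) ⟩
      ((+ (f (+ r (2 Nat.+ k)) %ℕ p ^ suc k) {{p^≢0 (suc k)}}) %ℕ p ^ k) {{p^≢0 k}}
        ≡⟨ ≡⇒%ℕ-≡ (p ^ k) {{p^≢0 k}}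
             (≡-factorʳ {p} (≡-sym (≡-%ℕ (p ^ suc k) {{p^≢0 (suc k)}} (f (+ r (2 Nat.+ k)))))) ⟩
      (f (+ r (2 Nat.+ k)) %ℕ p ^ k) {{p^≢0 k}}
        ≡⟨ ≡⇒%ℕ-≡ (p ^ k) {{p^≢0 k}} (f-cong (p ^ k) (level-≡ zr (ℕP.n≤1+n (suc k)))) ⟩
      (f (+ r (suc k)) %ℕ p ^ k) {{p^≢0 k}}
        ≡⟨ fₚ-level zr k ⟨
      fₚ r k ∎

  iter-level : ∀ {r} → IsZp p r → ∀ i k →
               iter i fₚ r k ≡ (iter i f (+ r (i Nat.+ k)) %ℕ p ^ k) {{p^≢0 k}}
  iter-level {r} zr zero    k = sym (ℕD.m<n⇒m%n≡m {{p^≢0 k}} (proj₁ zr k))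
  iter-level {r} zr (suc i) k = begin
    fₚ (iter i fₚ r) k
      ≡⟨ fₚ-level (iter-preserves (IsZp p) fₚ fₚ-IsZp i r zr) k ⟩
    (f (+ iter i fₚ r (suc k)) %ℕ p ^ k) {{p^≢0 k}}
      ≡⟨ cong (λ m → (f (+ m) %ℕ p ^ k) {{p^≢0 k}}) (iter-level zr i (suc k)) ⟩
    (f (+ (y %ℕ p ^ suc k) {{p^≢0 (suc k)}}) %ℕ p ^ k) {{p^≢0 k}}
      ≡⟨ ≡⇒%ℕ-≡ (p ^ k) {{p^≢0 k}} (f-cong (p ^ k) (≡-sym (≡-%ℕ (p ^ suc k) {{p^≢0 (suc k)}} y))) ⟩
    (f y %ℕ p ^ k) {{p^≢0 k}}
      ≡⟨ cong (λ K → (iter (suc i) f (+ r K) %ℕ p ^ k) {{p^≢0 k}}) (ℕP.+-suc i k) ⟩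
    (iter (suc i) f (+ r (suc i Nat.+ k)) %ℕ p ^ k) {{p^≢0 k}} ∎
    where
    open ≡-Reasoning
    y : ℤ
    y = iter i f (+ r (i Nat.+ suc k))

  xₚ-level : ∀ {r} → IsZp p r → ∀ {i K} → i < K → xₚ i r ≡ orbit-digit i (+ r K)
  xₚ-level {r} zr {i} {K} i<K = begin
    iter i fₚ r 1
      ≡⟨ iter-level zr i 1 ⟩
    (iter i f (+ r (i Nat.+ 1)) %ℕ p ^ 1) {{p^≢0 1}}
      ≡⟨ %ℕ-congʳ (iter i f (+ r (i Nat.+ 1))) {{p^≢0 1}} (ℕP.*-identityʳ p) ⟩
    orbit-digit i (+ r (i Nat.+ 1))
      ≡⟨ cong (λ j → orbit-digit i (+ r j)) (ℕP.+-comm i 1) ⟩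
    orbit-digit i (+ r (suc i))
      ≡⟨ orbit-digit-cong (suc i) (level-≡ zr i<K) i ℕP.≤-refl ⟨
    orbit-digit i (+ r K) ∎
    where open ≡-Reasoning

  xₚ-< : ∀ {r} → IsZp p r → ∀ i → xₚ i r < p
  xₚ-< {r} zr i = subst (_< p) (sym (xₚ-level zr {i} {suc i} ℕP.≤-refl)) (orbit-digit-< i (+ r (suc i)))

  Φₚ-level : ∀ {r} → IsZp p r → ∀ K → Φₚ r K ≡ Φ K (r K)
  Φₚ-level zr K = expand-cong K (λ i i<K → xₚ-level zr i<K)

  Φₚ-IsZp : ∀ r → IsZp p r → IsZp p (Φₚ r)
  Φₚ-IsZp r zr = (λ k → subst (_< p ^ k) (sym (Φₚ-level zr k)) (Φ-< k (r k))) ,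
                 (λ k → expand-%-truncate k (λ i → xₚ i r) (xₚ-< zr))

  Φₚ-cong : ∀ r s → IsZp p r → IsZp p s → _≈_ p r s → _≈_ p (Φₚ r) (Φₚ s)
  Φₚ-cong r s zr zs r≈s k = trans (Φₚ-level zr k) (trans (cong (Φ k) (r≈s k)) (sym (Φₚ-level zs k)))

  Φₚ-injective : ∀ r s → IsZp p r → IsZp p s → _≈_ p (Φₚ r) (Φₚ s) → _≈_ p r s
  Φₚ-injective r s zr zs Φr≈Φs k = Φ-injective k (r k) (s k) (proj₁ zr k) (proj₁ zs k)
    (trans (sym (Φₚ-level zr k)) (trans (Φr≈Φs k) (Φₚ-level zs k)))

  -- preimages chosen independently at each level are automatically compatible
  Φₚ-surjective : ∀ s → IsZp p s → Σ Seq λ r → IsZp p r × _≈_ p (Φₚ r) s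
  Φₚ-surjective s zs = r , zr , λ k → trans (Φₚ-level zr k) (Φr≡s k)
    where
    preimage : ∀ k → Σ ℕ λ n → n < p ^ k × Φ k n ≡ s k
    preimage k = Φ-surjective k (s k) (proj₁ zs k)
    r : Seq
    r k = proj₁ (preimage k)
    Φr≡s : ∀ k → Φ k (r k) ≡ s k
    Φr≡s k = proj₂ (proj₂ (preimage k))
    compatible : ∀ k → (r (suc k) % p ^ k) {{p^≢0 k}} ≡ r k
    compatible k = Φ-injective k _ (r k) (ℕD.m%n<n (r (suc k)) (p ^ k) {{p^≢0 k}})
                                         (proj₁ (proj₂ (preimage k))) (begin
      Φ k ((r (suc k) % p ^ k) {{p^≢0 k}})        ≡⟨ Φ-% k (r (suc k)) ⟩
      Φ k (r (suc k))                              ≡⟨ expand-%-truncate k _ (λ i → orbit-digit-< i _) ⟨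
      (Φ (suc k) (r (suc k)) % p ^ k) {{p^≢0 k}}  ≡⟨ cong (λ m → (m % p ^ k) {{p^≢0 k}}) (Φr≡s (suc k)) ⟩
      (s (suc k) % p ^ k) {{p^≢0 k}}              ≡⟨ proj₂ zs k ⟩
      s k                                          ≡⟨ Φr≡s k ⟨
      Φ k (r k)                                    ∎)
      where open ≡-Reasoning
    zr : IsZp p r
    zr = (λ k → proj₁ (proj₂ (preimage k))) , compatible

  Φₚ-conjugacy : ∀ r → IsZp p r → _≈_ p (Φₚ (fₚ r)) (σ p (Φₚ r))
  Φₚ-conjugacy r zr k = begin
    expand k (λ i → xₚ i (fₚ r))
      ≡⟨ expand-cong k (λ i _ → cong (λ s → s 1) (iter-suc i fₚ r)) ⟨
    expand k (λ i → xₚ (suc i) r)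
      ≡⟨ expand-/-p k (λ i → xₚ i r) (xₚ-< zr 0) ⟨
    expand (suc k) (λ i → xₚ i r) / p ∎
    where open ≡-Reasoning

  Φₚ-isomorphism : IsIsoZp p Φₚ (CEdgeZp p a b) (BEdgeZp p)
  Φₚ-isomorphism = Φₚ-IsZp , Φₚ-cong , Φₚ-injective , Φₚ-surjective , edges
    where
    -- s = f(r)  iff  Φ_p(s) = Φ_p(f(r)) = σ_p(Φ_p(r))
    edges : ∀ r s → IsZp p r → IsZp p s → CEdgeZp p a b r s ⇔ BEdgeZp p (Φₚ r) (Φₚ s)
    edges r s zr zs = mk⇔
      (λ s≈fr k → trans (Φₚ-cong s (fₚ r) zs (fₚ-IsZp r zr) s≈fr k) (Φₚ-conjugacy r zr k))
      (λ Φs≈σΦr → Φₚ-injective s (fₚ r) zs (fₚ-IsZp r zr)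
                    (λ k → trans (Φs≈σΦr k) (sym (Φₚ-conjugacy r zr k))))

-- Theorem 4: Φ_{p,k} is an isomorphism C^{(f)}(p,k) ≅ B(p,k) for k ≥ 1, and Φ_p is an isomorphism
-- C^{(f)}(ℤ_p) ≅ B(ℤ_p) conjugating f to σ_p.
theorem4 : (p : ℕ) .{{_ : NonZero p}} → 2 ≤ p → (a b : ℕ → ℤ) →
    (∀ i → i < p → + p ∣ᵤ (+ i * a i + b i)) →
    (∀ i → i < p → gcd ∣ a i ∣ p ≡ 1) →
    ((k : ℕ) → 1 ≤ k →
      IsomorphicBelow (p ^ k) (CEdge p a b k) (BEdge p k) ×
      IsIsoBelow (p ^ k) (Φk p a b k) (CEdge p a b k) (BEdge p k)) ×
    (IsomorphicZp p (CEdgeZp p a b) (BEdgeZp p) ×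
     IsIsoZp p (ΦZp p a b) (CEdgeZp p a b) (BEdgeZp p) ×
     (∀ r → IsZp p r → _≈_ p (ΦZp p a b (fZp p a b r)) (σ p (ΦZp p a b r))))
theorem4 p _ a b p∣ia+b a⊥p =
  (λ k 1≤k → (Φk p a b k , Φ-isomorphism k 1≤k) , Φ-isomorphism k 1≤k) ,
  (ΦZp p a b , Φₚ-isomorphism) , Φₚ-isomorphism , Φₚ-conjugacy
  where
  open AffineMap.Invertible p a b p∣ia+b a⊥p using (Φ-isomorphism)
  open PAdic p a b p∣ia+b a⊥p using (Φₚ-isomorphism; Φₚ-conjugacy)
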